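{- Let $n\in\mathbb N$ and $\alpha>0$ with $2\alpha n+1\le n$. Let $D$ be an $n$-vertex digraph with $\delta(D)\ge 2\alpha n$. Then there exists a partition $V(D)=V^+\cup V^-$ such that for each $*\in\{+,-\}$, $|V^*|\ge\alpha n/2$ and $d^*(v)\ge\alpha n/2$ for every $v\in V^*$.
   Context: $\delta(D)$ is the minimum total degree (number of edges incident to a vertex, i.e., indegree plus outdegree). $d^+(v)$ and $d^-(v)$ denote the out- and indegree of $v$ in $D$.
   Formalization: The parameter α ranges over the positive rationals. -}

module Defs where

open import Data.Nat using (ℕ; zero; suc; _+_)
open import Data.Bool using (Bool; true; false; not; if_then_else_)
open import Data.Fin using (Fin; zero; suc)
open import Data.Integer using (+_)
open import Data.Rational using (ℚ; _/_)
open import Relation.Binary.PropositionalEquality using (_≡_)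

count : ∀ {n} → (Fin n → Bool) → ℕ
count {zero}  P = 0
count {suc n} P = (if P zero then 1 else 0) + count (λ i → P (suc i))

ℕ→ℚ : ℕ → ℚ
ℕ→ℚ k = + k / 1

-- a (simple) digraph on vertex set Fin n: no loops, no parallel arcs
-- (arcs in both directions u→v and v→u are allowed)
record Digraph (n : ℕ) : Set where
  field
    arc     : Fin n → Fin n → Bool
    loopless : ∀ v → arc v v ≡ false

open Digraph public

outdeg : ∀ {n} → Digraph n → Fin n → ℕ
outdeg D v = count (λ u → arc D v u)

indeg : ∀ {n} → Digraph n → Fin n → ℕ
indeg D v = count (λ u → arc D u v)

deg : ∀ {n} → Digraph n → Fin n → ℕ
deg D v = outdeg D v + indeg D v

{-# OPTIONS --safe #-}
module Submission where

-- Round αn/2 up to an integer k = j + 1, so that δ(D) > 4j and n > 4j + 1.  As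
-- d⁺(v) + d⁻(v) > 2j, every vertex has d⁺(v) ≥ k or d⁻(v) ≥ k.  At least k vertices
-- have d⁻ ≥ k: a vertex with d⁻ < k has d⁺ ≥ d⁻ + 2j + 1, one with d⁻ ≥ k has
-- d⁻ ≤ d⁺ + n, so if there were only h < k of the latter then Σ d⁺ − Σ d⁻ ≥
-- (2j + 1)(n − h) − nh > 0, contradicting Σ d⁺ = Σ d⁻.  Reversing all arcs, at least
-- k vertices have d⁺ ≥ k.  Two such sets covering all n ≥ 2k vertices are trimmed,
-- one vertex at a time, into the parts V⁺ and V⁻.

open import Defs
open import Data.Nat as ℕ using (ℕ; zero; suc; z≤n; s≤s)
import Data.Nat.Properties as ℕ
open import Data.Bool using (Bool; true; false; not)
open import Data.Fin using (Fin; zero; suc)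
open import Data.Empty using (⊥-elim)
open import Data.Product using (Σ; _×_; ∃-syntax; _,_)
open import Function using (_∘_; case_of_)
open import Relation.Nullary using (yes; no)
open import Relation.Binary.PropositionalEquality
  using (_≡_; refl; sym; cong; cong₂; subst₂; module ≡-Reasoning)

module Combinatorics where
  open import Data.Nat using (pred; _+_; _*_; _≤_; _<_; _≤ᵇ_; _≤?_; _<?_)
  open import Data.Nat.Tactic.RingSolver using (solve-∀)
  open import Data.Bool using (if_then_else_; _∨_; T)
  open import Data.Bool.Properties using (T?; T-∨)
  open import Data.Sum using (_⊎_; inj₁; inj₂; [_,_])
  import Data.Sum as Sum
  open import Data.Vec.Functional using (_∷_)
  open import Function.Bundles using (Equivalence)
  open import Relation.Nullary using (¬_; Dec)
  open import Relation.Binary.PropositionalEquality using (subst; trans)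
  open import Algebra.Properties.Semiring.Sum ℕ.+-*-semiring
    using (sum-syntax; sum-cong-≗; ∑-comm; ∑-distrib-+)

  count≤n : ∀ {n} (P : Fin n → Bool) → count P ≤ n
  count≤n {zero}  P = z≤n
  count≤n {suc n} P with P zero
  ... | true  = s≤s (count≤n (P ∘ suc))
  ... | false = ℕ.m≤n⇒m≤1+n (count≤n (P ∘ suc))

  count+count-not≡n : ∀ {n} (P : Fin n → Bool) → count P + count (not ∘ P) ≡ n
  count+count-not≡n {zero}  P = refl
  count+count-not≡n {suc n} P with P zero
  ... | true  = cong suc (count+count-not≡n (P ∘ suc))
  ... | false = trans (ℕ.+-suc _ _) (cong suc (count+count-not≡n (P ∘ suc)))

  count≡∑ : ∀ {n} (P : Fin n → Bool) → count P ≡ ∑[ v < n ] (if P v then 1 else 0)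
  count≡∑ {zero}  P = refl
  count≡∑ {suc n} P = cong ((if P zero then 1 else 0) +_) (count≡∑ (P ∘ suc))

  ∑-if : ∀ {n} (P : Fin n → Bool) x y →
    ∑[ v < n ] (if P v then x else y) ≡ x * count P + y * count (not ∘ P)
  ∑-if {zero}  P x y = sym (cong₂ _+_ (ℕ.*-zeroʳ x) (ℕ.*-zeroʳ y))
  ∑-if {suc n} P x y with P zero
  ... | true  = begin
    x + ∑[ v < n ] (if P (suc v) then x else y)    ≡⟨ cong (x +_) (∑-if (P ∘ suc) x y) ⟩
    x + (x * c + y * d)                             ≡⟨ sym (ℕ.+-assoc x _ _) ⟩
    x + x * c + y * d                               ≡⟨ cong (_+ y * d) (sym (ℕ.*-suc x c)) ⟩
    x * suc c + y * d                               ∎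
    where
    open ≡-Reasoning
    c = count (P ∘ suc)
    d = count (not ∘ P ∘ suc)
  ... | false = begin
    y + ∑[ v < n ] (if P (suc v) then x else y)    ≡⟨ cong (y +_) (∑-if (P ∘ suc) x y) ⟩
    y + (x * c + y * d)                             ≡⟨ sym (ℕ.+-assoc y _ _) ⟩
    y + x * c + y * d                               ≡⟨ cong (_+ y * d) (ℕ.+-comm y _) ⟩
    x * c + y + y * d                               ≡⟨ ℕ.+-assoc (x * c) _ _ ⟩
    x * c + (y + y * d)                             ≡⟨ cong (x * c +_) (sym (ℕ.*-suc y d)) ⟩
    x * c + y * suc d                               ∎
    where
    open ≡-Reasoning
    c = count (P ∘ suc)
    d = count (not ∘ P ∘ suc)

  count-head-true : ∀ {n} (P : Fin (suc n) → Bool) → T (P zero) → count P ≡ suc (count (P ∘ suc))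
  count-head-true P p with P zero
  ... | true = refl

  count-head-false : ∀ {n} (P : Fin (suc n) → Bool) → ¬ T (P zero) → count P ≡ count (P ∘ suc)
  count-head-false P ¬p with P zero
  ... | true  = ⊥-elim (¬p _)
  ... | false = refl

  covering⇒n≤count+count : ∀ {n} (P M : Fin n → Bool) → (∀ v → T (P v ∨ M v)) →
    n ≤ count P + count M
  covering⇒n≤count+count {zero}  P M cover = z≤n
  covering⇒n≤count+count {suc n} P M cover
    with P zero | M zero | cover zero | covering⇒n≤count+count (P ∘ suc) (M ∘ suc) (cover ∘ suc)
  ... | true  | true  | _ | IH = s≤s (ℕ.≤-trans IH (ℕ.+-monoʳ-≤ (count (P ∘ suc)) (ℕ.n≤1+n _)))
  ... | true  | false | _ | IH = s≤s IH
  ... | false | true  | _ | IH = ℕ.≤-trans (s≤s IH) (ℕ.≤-reflexive (sym (ℕ.+-suc _ _)))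
  ... | false | false | () | _

  ∑-mono-≤ : ∀ {n} {f g : Fin n → ℕ} → (∀ v → f v ≤ g v) → ∑[ v < n ] f v ≤ ∑[ v < n ] g v
  ∑-mono-≤ {zero}  f≤g = z≤n
  ∑-mono-≤ {suc n} f≤g = ℕ.+-mono-≤ (f≤g zero) (∑-mono-≤ (f≤g ∘ suc))

  reverse : ∀ {n} → Digraph n → Digraph n
  reverse D = record { arc = λ u v → arc D v u ; loopless = loopless D }

  ∑outdeg≡∑indeg : ∀ {n} (D : Digraph n) → ∑[ v < n ] outdeg D v ≡ ∑[ v < n ] indeg D v
  ∑outdeg≡∑indeg {n} D = begin
    ∑[ v < n ] outdeg D v                                ≡⟨ sum-cong-≗ (λ v → count≡∑ (arc D v)) ⟩
    ∑[ v < n ] ∑[ u < n ] (if arc D v u then 1 else 0)  ≡⟨ ∑-comm (λ v u → if arc D v u then 1 else 0) ⟩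
    ∑[ u < n ] ∑[ v < n ] (if arc D v u then 1 else 0)  ≡⟨ sum-cong-≗ (λ u → count≡∑ (λ v → arc D v u)) ⟨
    ∑[ u < n ] indeg D u                                 ∎
    where open ≡-Reasoning

  2*j<a+b⇒j<a⊎j<b : ∀ {j a b} → 2 * j < a + b → j < a ⊎ j < b
  2*j<a+b⇒j<a⊎j<b {j} {a} {b} 2j<a+b with j <? a | j <? b
  ... | yes j<a | _       = inj₁ j<a
  ... | no  _   | yes j<b = inj₂ j<b
  ... | no  j≮a | no  j≮b =
    ⊥-elim (ℕ.<⇒≱ 2j<a+b (ℕ.+-mono-≤ (ℕ.≮⇒≥ j≮a) (ℕ.≤-trans (ℕ.≮⇒≥ j≮b) (ℕ.m≤m+n j 0))))

  i≤j⇒4j<o+i⇒2j+1+i≤o : ∀ {i j o} → i ≤ j → 4 * j < o + i → 2 * j + 1 + i ≤ o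
  i≤j⇒4j<o+i⇒2j+1+i≤o {i} {j} {o} i≤j 4j<o+i = ℕ.+-cancelʳ-≤ i _ o (begin
    2 * j + 1 + i + i  ≤⟨ ℕ.+-mono-≤ (ℕ.+-monoʳ-≤ (2 * j + 1) i≤j) i≤j ⟩
    2 * j + 1 + j + j  ≡⟨ 2j+1+j+j≡1+4j j ⟩
    suc (4 * j)        ≤⟨ 4j<o+i ⟩
    o + i              ∎)
    where
    open ℕ.≤-Reasoning
    2j+1+j+j≡1+4j : ∀ j → 2 * j + 1 + j + j ≡ suc (4 * j)
    2j+1+j+j≡1+4j = solve-∀

  [h+g]*h<[2j+1]*g : ∀ {h g j} → h ≤ j → 4 * j + 1 < h + g → (h + g) * h < (2 * j + 1) * g
  [h+g]*h<[2j+1]*g {h} {g} {j} h≤j 4j+1<h+g = begin-strict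
    (h + g) * h          ≡⟨ ℕ.*-distribʳ-+ h h g ⟩
    h * h + g * h        ≤⟨ ℕ.+-monoˡ-≤ (g * h) (ℕ.*-monoˡ-≤ h (ℕ.<⇒≤ h<g)) ⟩
    g * h + g * h        <⟨ ℕ.m<m+n (g * h + g * h) (ℕ.≤-<-trans z≤n h<g) ⟩
    g * h + g * h + g    ≡⟨ ghgh+g≡[2h+1]g g h ⟩
    (2 * h + 1) * g      ≤⟨ ℕ.*-monoˡ-≤ g (ℕ.+-monoˡ-≤ 1 (ℕ.*-monoʳ-≤ 2 h≤j)) ⟩
    (2 * j + 1) * g      ∎
    where
    open ℕ.≤-Reasoning
    ghgh+g≡[2h+1]g : ∀ g h → g * h + g * h + g ≡ (2 * h + 1) * g
    ghgh+g≡[2h+1]g = solve-∀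
    h<g : h < g
    h<g = ℕ.+-cancelˡ-< h h g (begin-strict
      h + h          ≤⟨ ℕ.+-mono-≤ h≤j h≤j ⟩
      j + j          ≤⟨ ℕ.+-monoʳ-≤ j (ℕ.m≤m+n j (j + (j + 0))) ⟩
      4 * j          ≤⟨ ℕ.m≤m+n (4 * j) 1 ⟩
      4 * j + 1      <⟨ 4j+1<h+g ⟩
      h + g          ∎)

  pred≤⇒≤suc : ∀ {a c} → pred a ≤ c → a ≤ suc c
  pred≤⇒≤suc {zero}  _ = z≤n
  pred≤⇒≤suc {suc a} h = s≤s h

  pred+≤ : ∀ {a b n} → a + b ≤ suc n → b ≤ n → pred a + b ≤ n
  pred+≤ {zero}  _           b≤n = b≤n
  pred+≤ {suc a} (s≤s a+b≤n) _   = a+b≤n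

  +pred≤ : ∀ {a b n} → a + b ≤ suc n → a ≤ n → a + pred b ≤ n
  +pred≤ {a} {zero}  _     a≤n = ℕ.≤-trans (ℕ.≤-reflexive (ℕ.+-identityʳ a)) a≤n
  +pred≤ {a} {suc b} a+b<n _   = ℕ.≤-pred (ℕ.≤-trans (ℕ.≤-reflexive (sym (ℕ.+-suc a b))) a+b<n)

  record Split {n} (P M : Fin n → Bool) (a b : ℕ) : Set where
    field
      side     : Fin n → Bool
      a≤count⁺ : a ≤ count side
      b≤count⁻ : b ≤ count (not ∘ side)
      side⁺⊆P  : ∀ v → side v ≡ true → T (P v)
      side⁻⊆M  : ∀ v → side v ≡ false → T (M v)

  module _ {n} {P M : Fin (suc n) → Bool} {a b : ℕ} where

    place⁺ : T (P zero) → Split (P ∘ suc) (M ∘ suc) (pred a) b → Split P M a b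
    place⁺ p s = record
      { side     = true ∷ side
      ; a≤count⁺ = pred≤⇒≤suc a≤count⁺
      ; b≤count⁻ = b≤count⁻
      ; side⁺⊆P  = λ { zero _ → p ; (suc v) → side⁺⊆P v }
      ; side⁻⊆M  = λ { zero () ; (suc v) → side⁻⊆M v }
      }
      where open Split s

    place⁻ : T (M zero) → Split (P ∘ suc) (M ∘ suc) a (pred b) → Split P M a b
    place⁻ m s = record
      { side     = false ∷ side
      ; a≤count⁺ = a≤count⁺
      ; b≤count⁻ = pred≤⇒≤suc b≤count⁻
      ; side⁺⊆P  = λ { zero () ; (suc v) → side⁺⊆P v }
      ; side⁻⊆M  = λ { zero _ → m ; (suc v) → side⁻⊆M v }
      }
      where open Split s

  split : ∀ {n} (P M : Fin n → Bool) {a b} → (∀ v → T (P v ∨ M v)) →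
    a ≤ count P → b ≤ count M → a + b ≤ n → Split P M a b
  split {zero} P M _ a≤P b≤M _ = record
    { side = λ () ; a≤count⁺ = a≤P ; b≤count⁻ = b≤M ; side⁺⊆P = λ () ; side⁻⊆M = λ () }
  split {suc n} P M {a} {b} cover a≤P b≤M a+b≤n = choose (T? (P zero)) (T? (M zero))
    where
    P′ = P ∘ suc
    M′ = M ∘ suc

    split′ : ∀ {a′ b′} → a′ ≤ count P′ → b′ ≤ count M′ → a′ + b′ ≤ n → Split P′ M′ a′ b′
    split′ = split P′ M′ (cover ∘ suc)

    put⁺ : T (P zero) → b ≤ count M′ → Split P M a b
    put⁺ p b≤M′ = place⁺ p (split′ a-1≤P′ b≤M′ (pred+≤ a+b≤n (ℕ.≤-trans b≤M′ (count≤n M′))))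
      where a-1≤P′ = ℕ.pred-mono-≤ (ℕ.≤-trans a≤P (ℕ.≤-reflexive (count-head-true P p)))

    put⁻ : T (M zero) → a ≤ count P′ → Split P M a b
    put⁻ m a≤P′ = place⁻ m (split′ a≤P′ b-1≤M′ (+pred≤ a+b≤n (ℕ.≤-trans a≤P′ (count≤n P′))))
      where b-1≤M′ = ℕ.pred-mono-≤ (ℕ.≤-trans b≤M (ℕ.≤-reflexive (count-head-true M m)))

    M′<b⇒a≤P′ : count M′ < b → a ≤ count P′
    M′<b⇒a≤P′ M′<b = ℕ.+-cancelʳ-≤ (suc (count M′)) a (count P′) (begin
      a + suc (count M′)        ≤⟨ ℕ.+-monoʳ-≤ a M′<b ⟩
      a + b                     ≤⟨ a+b≤n ⟩
      suc n                     ≤⟨ s≤s (covering⇒n≤count+count P′ M′ (cover ∘ suc)) ⟩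
      suc (count P′ + count M′) ≡⟨ ℕ.+-suc (count P′) (count M′) ⟨
      count P′ + suc (count M′) ∎)
      where open ℕ.≤-Reasoning

    choose : Dec (T (P zero)) → Dec (T (M zero)) → Split P M a b
    choose (no ¬p) (no ¬m) = ⊥-elim ([ ¬p , ¬m ] (Equivalence.to T-∨ (cover zero)))
    choose (yes p) (no ¬m) = put⁺ p (ℕ.≤-trans b≤M (ℕ.≤-reflexive (count-head-false M ¬m)))
    choose (no ¬p) (yes m) = put⁻ m (ℕ.≤-trans a≤P (ℕ.≤-reflexive (count-head-false P ¬p)))
    choose (yes p) (yes m) with b ≤? count M′
    ... | yes b≤M′ = put⁺ p b≤M′
    ... | no  b≰M′ = put⁻ m (M′<b⇒a≤P′ (ℕ.≰⇒> b≰M′))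

  many-large-indeg : ∀ {n} (D : Digraph n) {j} → (∀ v → 4 * j < deg D v) → 4 * j + 1 < n →
    suc j ≤ count (λ v → suc j ≤ᵇ indeg D v)
  many-large-indeg {n} D {j} δ>4j n>4j+1 = ℕ.≮⇒≥ (h≰j ∘ ℕ.≤-pred)
    where
    H : Fin n → Bool
    H v = suc j ≤ᵇ indeg D v
    h = count H
    g = count (not ∘ H)
    h+g≡n = count+count-not≡n H

    weighted : ∀ v → (if H v then 0 else 2 * j + 1) + indeg D v ≤ (if H v then n else 0) + outdeg D v
    weighted v with H v in eq
    ... | true  = ℕ.≤-trans (count≤n _) (ℕ.m≤m+n n _)
    ... | false = i≤j⇒4j<o+i⇒2j+1+i≤o (ℕ.≮⇒≥ (subst T eq ∘ ℕ.≤⇒≤ᵇ)) (δ>4j v)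

    [2j+1]*g≤[h+g]*h : (2 * j + 1) * g ≤ (h + g) * h
    [2j+1]*g≤[h+g]*h = ℕ.+-cancelʳ-≤ (∑[ v < n ] indeg D v) _ _ (begin
      (2 * j + 1) * g + ∑[ v < n ] indeg D v
        ≡⟨ cong (_+ ∑[ v < n ] indeg D v) (∑-if H 0 (2 * j + 1)) ⟨
      ∑[ v < n ] (if H v then 0 else 2 * j + 1) + ∑[ v < n ] indeg D v
        ≡⟨ ∑-distrib-+ (λ v → if H v then 0 else 2 * j + 1) (indeg D) ⟨
      ∑[ v < n ] ((if H v then 0 else 2 * j + 1) + indeg D v)
        ≤⟨ ∑-mono-≤ weighted ⟩
      ∑[ v < n ] ((if H v then n else 0) + outdeg D v)
        ≡⟨ ∑-distrib-+ (λ v → if H v then n else 0) (outdeg D) ⟩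
      ∑[ v < n ] (if H v then n else 0) + ∑[ v < n ] outdeg D v
        ≡⟨ cong₂ _+_ (∑-if H n 0) (∑outdeg≡∑indeg D) ⟩
      n * h + 0 + ∑[ v < n ] indeg D v
        ≡⟨ cong (λ m → m * h + 0 + ∑[ v < n ] indeg D v) h+g≡n ⟨
      (h + g) * h + 0 + ∑[ v < n ] indeg D v
        ≡⟨ cong (_+ ∑[ v < n ] indeg D v) (ℕ.+-identityʳ _) ⟩
      (h + g) * h + ∑[ v < n ] indeg D v ∎)
      where open ℕ.≤-Reasoning

    h≰j : ¬ h ≤ j
    h≰j h≤j = ℕ.<⇒≱ ([h+g]*h<[2j+1]*g h≤j (subst (4 * j + 1 <_) (sym h+g≡n) n>4j+1)) [2j+1]*g≤[h+g]*h

  partitionℕ : ∀ {n} (D : Digraph n) {j} → (∀ v → 4 * j < deg D v) → 4 * j + 1 < n →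
    Split (λ v → suc j ≤ᵇ outdeg D v) (λ v → suc j ≤ᵇ indeg D v) (suc j) (suc j)
  partitionℕ {n} D {j} δ>4j n>4j+1 =
    split _ _ cover (many-large-indeg (reverse D) δᴿ>4j n>4j+1) (many-large-indeg D δ>4j n>4j+1) 2j+2≤n
    where
    cover : ∀ v → T ((suc j ≤ᵇ outdeg D v) ∨ (suc j ≤ᵇ indeg D v))
    cover v = Equivalence.from (T-∨ {suc j ≤ᵇ outdeg D v}) (Sum.map ℕ.≤⇒≤ᵇ ℕ.≤⇒≤ᵇ
      (2*j<a+b⇒j<a⊎j<b {j} {outdeg D v} (ℕ.≤-<-trans (ℕ.*-monoˡ-≤ j (ℕ.m≤m+n 2 2)) (δ>4j v))))
    δᴿ>4j : ∀ v → 4 * j < deg (reverse D) v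
    δᴿ>4j v = subst (4 * j <_) (ℕ.+-comm (outdeg D v) (indeg D v)) (δ>4j v)
    2j+2≤n : suc j + suc j ≤ n
    2j+2≤n = ℕ.≤-trans (ℕ.m≤m+n (suc j + suc j) (2 * j)) (ℕ.≤-trans (ℕ.≤-reflexive (2j+2+2j≡4j+1+1 j)) n>4j+1)
      where
      2j+2+2j≡4j+1+1 : ∀ j → suc j + suc j + 2 * j ≡ suc (4 * j + 1)
      2j+2+2j≡4j+1+1 = solve-∀

open Combinatorics using (Split; partitionℕ)

open import Data.Nat.Coprimality using (1-coprimeTo)
import Data.Nat.Coprimality as Coprime
open import Data.Integer as ℤ using (+_)
import Data.Integer.Properties as ℤ
open import Data.Rational
  using (ℚ; mkℚ; _/_; _≤_; _<_; _*_; _+_; 0ℚ; 1ℚ; ½; *≤*; Positive; NonNegative; positive)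
import Data.Rational.Properties as ℚ

-- ℕ→ℚ k is normalised through gcd k 1, which does not compute for a variable k.
ℕ→ℚ≡mkℚ : ∀ k → ℕ→ℚ k ≡ mkℚ (+ k) 0 (Coprime.sym (1-coprimeTo k))
ℕ→ℚ≡mkℚ k = ℚ.normalize-coprime (Coprime.sym (1-coprimeTo k))

ℕ→ℚ-mono-≤ : ∀ {a b} → a ℕ.≤ b → ℕ→ℚ a ≤ ℕ→ℚ b
ℕ→ℚ-mono-≤ {a} {b} a≤b rewrite ℕ→ℚ≡mkℚ a | ℕ→ℚ≡mkℚ b =
  *≤* (subst₂ ℤ._≤_ (sym (ℤ.*-identityʳ (+ a))) (sym (ℤ.*-identityʳ (+ b))) (ℤ.+≤+ a≤b))

ℕ→ℚ-cancel-< : ∀ {a b} → ℕ→ℚ a < ℕ→ℚ b → a ℕ.< b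
ℕ→ℚ-cancel-< a<b = ℕ.≰⇒> (λ b≤a → ℚ.<-irrefl refl (ℚ.<-≤-trans a<b (ℕ→ℚ-mono-≤ b≤a)))

ℕ→ℚ-+ : ∀ a b → ℕ→ℚ (a ℕ.+ b) ≡ ℕ→ℚ a + ℕ→ℚ b
ℕ→ℚ-+ a b rewrite ℕ→ℚ≡mkℚ a | ℕ→ℚ≡mkℚ b =
  cong (_/ 1) (sym (cong₂ ℤ._+_ (ℤ.*-identityʳ (+ a)) (ℤ.*-identityʳ (+ b))))

ℕ→ℚ-* : ∀ a b → ℕ→ℚ (a ℕ.* b) ≡ ℕ→ℚ a * ℕ→ℚ b
ℕ→ℚ-* a b rewrite ℕ→ℚ≡mkℚ a | ℕ→ℚ≡mkℚ b = cong (_/ 1) (ℤ.pos-* a b)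

ℕ→ℚ-pos : ∀ k → Positive (ℕ→ℚ (suc k))
ℕ→ℚ-pos k rewrite ℕ→ℚ≡mkℚ (suc k) = _

∃-ceiling : ∀ {x} B → 0ℚ < x → x ≤ ℕ→ℚ B → ∃[ j ] ℕ→ℚ j < x × x ≤ ℕ→ℚ (suc j)
∃-ceiling zero    0<x x≤0 = ⊥-elim (ℚ.<-irrefl refl (ℚ.<-≤-trans 0<x x≤0))
∃-ceiling {x} (suc B) 0<x x≤1+B with x ℚ.≤? ℕ→ℚ B
... | yes x≤B = ∃-ceiling B 0<x x≤B
... | no  x≰B = B , ℚ.≰⇒> x≰B , x≤1+B

a<q⇒q+1≤b⇒a+1<b : ∀ {a b q} → ℕ→ℚ a < q → q + 1ℚ ≤ ℕ→ℚ b → a ℕ.+ 1 ℕ.< b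
a<q⇒q+1≤b⇒a+1<b {a} {b} {q} a<q q+1≤b = ℕ→ℚ-cancel-< (begin-strict
  ℕ→ℚ (a ℕ.+ 1)   ≡⟨ ℕ→ℚ-+ a 1 ⟩
  ℕ→ℚ a + 1ℚ      <⟨ ℚ.+-monoˡ-< 1ℚ a<q ⟩
  q + 1ℚ          ≤⟨ q+1≤b ⟩
  ℕ→ℚ b           ∎)
  where open ℚ.≤-Reasoning

round-up : ∀ α m → 0ℚ < α → ℕ→ℚ 2 * α * ℕ→ℚ (suc m) + 1ℚ ≤ ℕ→ℚ (suc m) →
  ∃[ j ] ℕ→ℚ (4 ℕ.* j) < ℕ→ℚ 2 * α * ℕ→ℚ (suc m) × ½ * α * ℕ→ℚ (suc m) ≤ ℕ→ℚ (suc j)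
round-up α m 0<α 2αn+1≤n =
  let j , j<x , x≤1+j = ∃-ceiling n (ℚ.positive⁻¹ x) x≤n in j , 4j<2αn j j<x , x≤1+j
  where
  n = suc m
  x = ½ * α * ℕ→ℚ n
  2αn = ℕ→ℚ 2 * α * ℕ→ℚ n

  instance
    α-pos : Positive α
    α-pos = positive 0<α
    n-pos : Positive (ℕ→ℚ n)
    n-pos = ℕ→ℚ-pos m
    ½α-pos : Positive (½ * α)
    ½α-pos = ℚ.pos*pos⇒pos ½ α
    x-pos : Positive x
    x-pos = ℚ.pos*pos⇒pos (½ * α) (ℕ→ℚ n)
    x-nonNeg : NonNegative x
    x-nonNeg = ℚ.pos⇒nonNeg x

  4x≡2αn : ℕ→ℚ 4 * x ≡ 2αn
  4x≡2αn = begin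
    ℕ→ℚ 4 * (½ * α * ℕ→ℚ n)   ≡⟨ ℚ.*-assoc (ℕ→ℚ 4) (½ * α) (ℕ→ℚ n) ⟨
    ℕ→ℚ 4 * (½ * α) * ℕ→ℚ n   ≡⟨ cong (_* ℕ→ℚ n) (ℚ.*-assoc (ℕ→ℚ 4) ½ α) ⟨
    ℕ→ℚ 4 * ½ * α * ℕ→ℚ n     ≡⟨⟩
    2αn                       ∎
    where open ≡-Reasoning

  x≤n : x ≤ ℕ→ℚ n
  x≤n = begin
    x             ≡⟨ ℚ.*-identityˡ x ⟨
    1ℚ * x        ≤⟨ ℚ.*-monoʳ-≤-nonNeg x (ℕ→ℚ-mono-≤ {1} {4} (s≤s z≤n)) ⟩
    ℕ→ℚ 4 * x     ≡⟨ 4x≡2αn ⟩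
    2αn           ≡⟨ ℚ.+-identityʳ 2αn ⟨
    2αn + 0ℚ      ≤⟨ ℚ.+-monoʳ-≤ 2αn (ℕ→ℚ-mono-≤ {0} {1} z≤n) ⟩
    2αn + 1ℚ      ≤⟨ 2αn+1≤n ⟩
    ℕ→ℚ n         ∎
    where open ℚ.≤-Reasoning

  4j<2αn : ∀ j → ℕ→ℚ j < x → ℕ→ℚ (4 ℕ.* j) < 2αn
  4j<2αn j j<x = begin-strict
    ℕ→ℚ (4 ℕ.* j)     ≡⟨ ℕ→ℚ-* 4 j ⟩
    ℕ→ℚ 4 * ℕ→ℚ j     <⟨ ℚ.*-monoʳ-<-pos (ℕ→ℚ 4) j<x ⟩
    ℕ→ℚ 4 * x         ≡⟨ 4x≡2αn ⟩
    2αn               ∎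
    where open ℚ.≤-Reasoning

partition≥ : ∀ {n} (D : Digraph n) j {x} → (∀ v → 4 ℕ.* j ℕ.< deg D v) → 4 ℕ.* j ℕ.+ 1 ℕ.< n →
  x ≤ ℕ→ℚ (suc j) →
  Σ (Fin n → Bool) λ side →
    (x ≤ ℕ→ℚ (count side)) × (x ≤ ℕ→ℚ (count (not ∘ side))) ×
    (∀ v → side v ≡ true → x ≤ ℕ→ℚ (outdeg D v)) × (∀ v → side v ≡ false → x ≤ ℕ→ℚ (indeg D v))
partition≥ D j {x} δ>4j n>4j+1 x≤1+j =
  side , raise a≤count⁺ , raise b≤count⁻ ,
  (λ v → raise ∘ ℕ.≤ᵇ⇒≤ (suc j) (outdeg D v) ∘ side⁺⊆P v) ,
  (λ v → raise ∘ ℕ.≤ᵇ⇒≤ (suc j) (indeg D v) ∘ side⁻⊆M v)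
  where
  open Split (partitionℕ D {j} δ>4j n>4j+1)
  raise : ∀ {a} → suc j ℕ.≤ a → x ≤ ℕ→ℚ a
  raise {a} = ℚ.≤-trans x≤1+j ∘ ℕ→ℚ-mono-≤ {suc j} {a}

fact6p5 : (n : ℕ) (α : ℚ) → 0ℚ < α →
    (ℕ→ℚ 2 * α * ℕ→ℚ n + 1ℚ ≤ ℕ→ℚ n) →
    (D : Digraph n) →
    (∀ v → ℕ→ℚ 2 * α * ℕ→ℚ n ≤ ℕ→ℚ (deg D v)) →
    Σ (Fin n → Bool) λ side →
      (½ * α * ℕ→ℚ n ≤ ℕ→ℚ (count (λ v → side v))) ×
      (½ * α * ℕ→ℚ n ≤ ℕ→ℚ (count (λ v → not (side v)))) ×
      (∀ v → side v ≡ true → ½ * α * ℕ→ℚ n ≤ ℕ→ℚ (outdeg D v)) ×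
      (∀ v → side v ≡ false → ½ * α * ℕ→ℚ n ≤ ℕ→ℚ (indeg D v))
fact6p5 zero α _ _ _ _ = (λ ()) , αn/2≤0 , αn/2≤0 , (λ ()) , (λ ())
  where αn/2≤0 = ℚ.≤-reflexive (ℚ.*-zeroʳ (½ * α))
fact6p5 (suc m) α 0<α 2αn+1≤n D δ≥2αn = case round-up α m 0<α 2αn+1≤n of λ
  { (j , 4j<2αn , αn/2≤1+j) → partition≥ D j
      (λ v → ℕ→ℚ-cancel-< (ℚ.<-≤-trans 4j<2αn (δ≥2αn v)))
      (a<q⇒q+1≤b⇒a+1<b 4j<2αn 2αn+1≤n)
      αn/2≤1+j
  }
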